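{- In the free PAN algebra on a vector space $V$ (with basis the pointed sets whose elements are labelled by basis elements of $V$), for all pointed sets $u$ and $v$: $$\Delta(u\leftharpoondown v)=\begin{cases}u\otimes v+\sum_{a\in u,\ a\neq x}\big((u\setminus\{a\})\leftharpoondown v\big)\otimes\{\mathbf{a}\}&\text{if } v \text{ has exactly one element},\\ 0&\text{otherwise},\end{cases}$$ where $x$ is the pointed element of $u$; in Sweedler notation $\Delta(u)=u_1\otimes u_2$, this reads $\Delta(u\leftharpoondown v)=\delta_{v\in\mathrm{PAN}(1)}\big(u\otimes v+(u_1\leftharpoondown v)\otimes u_2\big)$.
   Context: A PAN algebra is a vector space with a bilinear product $\leftharpoondown$ satisfying $x\leftharpoondown(y\leftharpoondown z)=0$ and $(x\leftharpoondown y)\leftharpoondown z=(x\leftharpoondown z)\leftharpoondown y$. In the free PAN algebra, the product of pointed sets $\{\mathbf{x_1},x_2,\dots,x_k\}$ (pointed at $x_1$) and $\{\mathbf{y_1},\dots,y_l\}$ is the pointed set $\{\mathbf{x_1},x_2,\dots,x_k,y_1\}$ if $l=1$, and $0$ otherwise. The coproduct dual to this product is $\Delta(u)=\sum_{a\in u,\ a\neq x}(u\setminus\{a\})\otimes\{\mathbf{a}\}$, where $x$ is the pointed element of $u$, $u\setminus\{a\}$ remains pointed at $x$ and $\{\mathbf{a}\}$ is the singleton pointed at $a$. $\delta_{v\in\mathrm{PAN}(1)}$ is $1$ if $v$ is a singleton and $0$ otherwise. -}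

module Defs where

open import Level using (Level)
open import Data.List using (List; []; _∷_; _++_; map; concatMap; cartesianProduct; [_])
open import Data.Product using (_×_; _,_; proj₁; proj₂)
open import Data.Product.Relation.Binary.Pointwise.NonDependent using (×-setoid)
open import Relation.Binary.Bundles using (Setoid)
open import Relation.Binary.PropositionalEquality using (setoid)
import Data.List.Relation.Binary.Permutation.Propositional as PermP
import Data.List.Relation.Binary.Permutation.Setoid as PermS

-- Throughout, L is a type indexing the chosen basis of V (the labels).

module PAN {ℓ : Level} (L : Set ℓ) where

  -- A pointed set labelled by basis elements of V: the pointed element x
  -- together with the (unordered) list of the remaining elements.
  -- Since elements are labelled, labels may repeat; order of the tail is
  -- irrelevant, which is accounted for by the equality _≈P_ below.
  PSet : Set ℓ
  PSet = L × List L

  point : PSet → L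
  point = proj₁

  rest : PSet → List L
  rest = proj₂

  PSetSetoid : Setoid ℓ ℓ
  PSetSetoid = ×-setoid (setoid L) (PermP.↭-setoid {A = L})

  sing : L → PSet
  sing a = (a , [])

  -- Elements of the free PAN algebra and of its tensor square, as formal sums
  -- of basis elements (the empty list is 0, ++ is addition).
  PAN : Set ℓ
  PAN = List PSet

  PAN⊗PAN : Set ℓ
  PAN⊗PAN = List (PSet × PSet)

  TensorSetoid : Setoid ℓ ℓ
  TensorSetoid = PermS.↭-setoid (×-setoid PSetSetoid PSetSetoid)

  _≈⊗_ : PAN⊗PAN → PAN⊗PAN → Set ℓ
  _≈⊗_ = Setoid._≈_ TensorSetoid

  _⇀b_ : PSet → PSet → PAN
  (x , t) ⇀b (y , []) = [ (x , t ++ [ y ]) ]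
  (x , t) ⇀b (y , _ ∷ _) = []

  _⇀_ : PAN → PAN → PAN
  p ⇀ q = concatMap (λ uv → proj₁ uv ⇀b proj₂ uv) (cartesianProduct p q)

  _⊗_ : PAN → PAN → PAN⊗PAN
  p ⊗ q = cartesianProduct p q

  removals : List L → List (L × List L)
  removals [] = []
  removals (a ∷ t) = (a , t) ∷ map (λ br → proj₁ br , a ∷ proj₂ br) (removals t)

  Δb : PSet → PAN⊗PAN
  Δb (x , t) = map (λ ar → ((x , proj₂ ar) , sing (proj₁ ar))) (removals t)

  Δ : PAN → PAN⊗PAN
  Δ = concatMap Δb

-- Multiplying u by a singleton {y} appends y to u.  The coproduct of u ⇀ {y}
-- then splits into the term removing the new element y, which gives back
-- u ⊗ {y}, and the terms removing an old element a, which are exactly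
-- ((u ∖ {a}) ⇀ {y}) ⊗ {a}.  If v is not a singleton, u ⇀ v = 0.
module Submission where

open import Defs
open import Level using (Level)
open import Data.List using (List; []; _∷_; _++_; _∷ʳ_; concatMap; [_]; map)
open import Data.List.Properties using (map-++; map-∘; ++-identityʳ; concatMap-map; concatMap-pure)
open import Data.Product using (_×_; _,_; proj₁; proj₂; map₂)
open import Data.Product.Relation.Binary.Pointwise.NonDependent using (×-setoid)
open import Relation.Binary.PropositionalEquality using (_≡_; _≢_; refl; cong; module ≡-Reasoning)
open import Relation.Nullary using (contradiction)
open import Function using (_∘_)
open import Relation.Binary.Bundles using (Setoid)
import Data.List.Relation.Binary.Permutation.Setoid as PermS
import Data.List.Relation.Binary.Permutation.Setoid.Properties as PermSP

module _ {ℓ : Level} (L : Set ℓ) where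
  open PAN L

  removals-∷ʳ : (t : List L) (y : L) →
    removals (t ∷ʳ y) ≡ map (map₂ (_∷ʳ y)) (removals t) ∷ʳ (y , t)
  removals-∷ʳ []      y = refl
  removals-∷ʳ (a ∷ t) y = cong ((a , t ∷ʳ y) ∷_) (begin
    map (map₂ (a ∷_)) (removals (t ∷ʳ y))
      ≡⟨ cong (map (map₂ (a ∷_))) (removals-∷ʳ t y) ⟩
    map (map₂ (a ∷_)) (map (map₂ (_∷ʳ y)) (removals t) ∷ʳ (y , t))
      ≡⟨ map-++ (map₂ (a ∷_)) (map (map₂ (_∷ʳ y)) (removals t)) [ (y , t) ] ⟩
    map (map₂ (a ∷_)) (map (map₂ (_∷ʳ y)) (removals t)) ∷ʳ (y , a ∷ t)
      ≡⟨ cong (_∷ʳ (y , a ∷ t)) (begin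
           map (map₂ (a ∷_)) (map (map₂ (_∷ʳ y)) (removals t)) ≡⟨ map-∘ (removals t) ⟨
           map (map₂ ((a ∷_) ∘ (_∷ʳ y))) (removals t) ≡⟨ map-∘ (removals t) ⟩
           map (map₂ (_∷ʳ y)) (map (map₂ (a ∷_)) (removals t)) ∎) ⟩
    map (map₂ (_∷ʳ y)) (map (map₂ (a ∷_)) (removals t)) ∷ʳ (y , a ∷ t) ∎)
    where open ≡-Reasoning

  Δ-term : L → L × List L → PSet × PSet
  Δ-term x ar = ((x , proj₂ ar) , sing (proj₁ ar))

  Δ-⇀-sing : (x : L) (t : List L) (y : L) →
    Δ ([ (x , t) ] ⇀ [ sing y ])
      ≡ map (Δ-term x ∘ map₂ (_∷ʳ y)) (removals t) ∷ʳ ((x , t) , sing y)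
  Δ-⇀-sing x t y = begin
    Δb (x , t ∷ʳ y) ++ []
      ≡⟨ ++-identityʳ _ ⟩
    map (Δ-term x) (removals (t ∷ʳ y))
      ≡⟨ cong (map (Δ-term x)) (removals-∷ʳ t y) ⟩
    map (Δ-term x) (map (map₂ (_∷ʳ y)) (removals t) ∷ʳ (y , t))
      ≡⟨ map-++ (Δ-term x) _ [ (y , t) ] ⟩
    map (Δ-term x) (map (map₂ (_∷ʳ y)) (removals t)) ∷ʳ ((x , t) , sing y)
      ≡⟨ cong (_∷ʳ ((x , t) , sing y)) (map-∘ (removals t)) ⟨
    map (Δ-term x ∘ map₂ (_∷ʳ y)) (removals t) ∷ʳ ((x , t) , sing y) ∎
    where open ≡-Reasoning

  ⇀-sing-⊗-sum : (x y : L) (zs : List (L × List L)) →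
    concatMap (λ ar → ([ (x , proj₂ ar) ] ⇀ [ sing y ]) ⊗ [ sing (proj₁ ar) ]) zs
      ≡ map (Δ-term x ∘ map₂ (_∷ʳ y)) zs
  ⇀-sing-⊗-sum x y zs = begin
    concatMap ([_] ∘ f) zs    ≡⟨ concatMap-map [_] f zs ⟨
    concatMap [_] (map f zs)  ≡⟨ concatMap-pure (map f zs) ⟩
    map f zs                  ∎
    where
    open ≡-Reasoning
    f : L × List L → PSet × PSet
    f = Δ-term x ∘ map₂ (_∷ʳ y)

  private
    PSet²-setoid : Setoid ℓ ℓ
    PSet²-setoid = ×-setoid PSetSetoid PSetSetoid

  Δ-⇀-sing-≈⊗ : (x : L) (t : List L) (y : L) →
    Δ ([ (x , t) ] ⇀ [ sing y ]) ≈⊗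
      (((x , t) , sing y) ∷ concatMap
         (λ ar → ([ (x , proj₂ ar) ] ⇀ [ sing y ]) ⊗ [ sing (proj₁ ar) ]) (removals t))
  Δ-⇀-sing-≈⊗ x t y = begin
    Δ ([ (x , t) ] ⇀ [ sing y ])
      ≡⟨ Δ-⇀-sing x t y ⟩
    terms (removals t) ∷ʳ ((x , t) , sing y)
      ↭⟨ PermSP.∷↭∷ʳ PSet²-setoid _ _ ⟨
    ((x , t) , sing y) ∷ terms (removals t)
      ≡⟨ cong (((x , t) , sing y) ∷_) (⇀-sing-⊗-sum x y (removals t)) ⟨
    ((x , t) , sing y) ∷ concatMap
      (λ ar → ([ (x , proj₂ ar) ] ⇀ [ sing y ]) ⊗ [ sing (proj₁ ar) ]) (removals t) ∎
    where
    open PermS PSet²-setoid using (module PermutationReasoning)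
    open PermutationReasoning
    terms : List (L × List L) → PAN⊗PAN
    terms = map (Δ-term x ∘ map₂ (_∷ʳ y))

proposition2p5p2 : {ℓ : Level} (L : Set ℓ) → let open PAN L in
    (u v : PSet) →
      ((rest v ≡ [] →
          Δ ([ u ] ⇀ [ v ]) ≈⊗
            ((u , v) ∷ concatMap
               (λ ar → ([ (point u , proj₂ ar) ] ⇀ [ v ]) ⊗ [ sing (proj₁ ar) ])
               (removals (rest u))))
      × (rest v ≢ [] → Δ ([ u ] ⇀ [ v ]) ≈⊗ []))
proposition2p5p2 L (x , t) (y , []) =
  (λ _ → Δ-⇀-sing-≈⊗ L x t y) , λ v≢sing → contradiction refl v≢sing
proposition2p5p2 L u (y , _ ∷ _) =
  (λ ()) , λ _ → PermS.↭-refl (×-setoid PSetSetoid PSetSetoid)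
  where open PAN L
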